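{- Let $F$ be a CNF formula and let $m\ge 2$. If there is a treelike resolution refutation of $\mathrm{XOR}_m(F)$ of width $w$ and size $s$, then there is a resolution refutation of $F$ of width $\frac{w}{m-1}$ and depth $\log s$.
   Context: For a CNF $F$ over variables $x_1,\dots,x_n$, $\mathrm{XOR}_m(F)$ is obtained by substituting each $x_i$ by $y_{i,1}\oplus\cdots\oplus y_{i,m}$ with fresh variables $y_{i,j}$ and expanding each resulting constraint into its canonical CNF (a clause of width $w'$ becomes the $2^{(m-1)w'}$ clauses of width $mw'$ expressing it). A resolution refutation is a sequence of clauses ending in the empty clause, each an axiom or derived from earlier $C\lor x$, $D\lor\neg x$ as $C\lor D$; width is the maximum clause width, size the number of clauses, depth the number of edges on a longest path in the derivation DAG (edges from premises to derived clause). It is treelike if this DAG is a tree. Logarithms are base 2. -}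

module Defs where

open import Data.Nat using (ℕ; zero; suc; _+_; _*_; _≤_; _<_)
open import Data.Bool using (Bool; true; false; not; _∧_; _∨_; _xor_; if_then_else_)
open import Data.Fin using (Fin; zero; suc; combine; fromℕ; toℕ)
import Data.Fin as Fin
open import Data.Maybe using (Maybe; just; nothing)
open import Data.List using (List)
open import Data.List.Relation.Unary.Any using (Any)
open import Data.Product using (Σ; _×_; ∃; ∃-syntax)
open import Relation.Binary.PropositionalEquality using (_≡_; _≢_)
open import Relation.Nullary using (does)
import Data.Bool as B

-- A literal is a pair (v , b) : Fin N × Bool; (v , true) is x_v and
-- (v , false) is ¬x_v.  A clause is a (finite) set of literals, given by
-- its characteristic function.

Clause : ℕ → Set
Clause N = Fin N → Bool → Bool

_≈C_ : ∀ {N} → Clause N → Clause N → Set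
C ≈C D = ∀ v b → C v b ≡ D v b

CNF : ℕ → Set
CNF n = List (Clause n)

sumFin : ∀ {N} → (Fin N → ℕ) → ℕ
sumFin {zero}  f = 0
sumFin {suc N} f = f zero + sumFin (λ i → f (suc i))

b2n : Bool → ℕ
b2n true  = 1
b2n false = 0

clauseWidth : ∀ {N} → Clause N → ℕ
clauseWidth C = sumFin (λ v → b2n (C v true) + b2n (C v false))

IsEmpty : ∀ {N} → Clause N → Set
IsEmpty C = ∀ v b → C v b ≡ false

IsResolvent : ∀ {N} → Fin N → Clause N → Clause N → Clause N → Set
IsResolvent v A B C =
  ∀ u b → C u b ≡ ((A u b ∧ not (does (u Fin.≟ v) ∧ does (b B.≟ true)))
                  ∨ (B u b ∧ not (does (u Fin.≟ v) ∧ does (b B.≟ false))))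

-- A refutation is a sequence of clauses cl 0, ..., cl len (size = suc len),
-- each equipped with a justification; the last one is empty.

data Step {N : ℕ} (Ax : Clause N → Set) {s : ℕ} (cl : Fin s → Clause N)
          (k : Fin s) : Set where
  axiom : Ax (cl k) → Step Ax cl k
  res   : (i j : Fin s) → toℕ i < toℕ k → toℕ j < toℕ k → (v : Fin N) →
          cl i v true ≡ true → cl j v false ≡ true →
          IsResolvent v (cl i) (cl j) (cl k) → Step Ax cl k

record Refutation (N : ℕ) (Ax : Clause N → Set) : Set where
  field
    len    : ℕ
    clause : Fin (suc len) → Clause N
    step   : (k : Fin (suc len)) → Step Ax clause k
    ends   : IsEmpty (clause (fromℕ len))

open Refutation public

size : ∀ {N Ax} → Refutation N Ax → ℕ
size π = suc (len π)

WidthAtMost : ∀ {N Ax} → Refutation N Ax → ℕ → Set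
WidthAtMost π w = ∀ k → clauseWidth (clause π k) ≤ w

premiseAt : ∀ {N Ax} (π : Refutation N Ax) → Fin (size π) → Bool →
            Maybe (Fin (size π))
premiseAt π k side with step π k
... | axiom _ = nothing
... | res i j _ _ _ _ _ _ = if side then just i else just j

Edge : ∀ {N Ax} (π : Refutation N Ax) → Fin (size π) → Fin (size π) → Set
Edge π i k = ∃[ side ] premiseAt π k side ≡ just i

data Path {N Ax} (π : Refutation N Ax) : Fin (size π) → Fin (size π) → ℕ → Set where
  here : ∀ {a} → Path π a a 0
  next : ∀ {a b c ℓ} → Path π a b ℓ → Edge π b c → Path π a c (suc ℓ)

DepthAtMost : ∀ {N Ax} → Refutation N Ax → ℕ → Set
DepthAtMost π d = ∀ a b ℓ → Path π a b ℓ → ℓ ≤ d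

-- the DAG is a tree (rooted at the final empty clause): every premise
-- occurrence refers to a distinct line (each line is used at most once),
-- and every line other than the last is used.
Treelike : ∀ {N Ax} → Refutation N Ax → Set
Treelike π =
  (∀ k₁ s₁ k₂ s₂ i → premiseAt π k₁ s₁ ≡ just i → premiseAt π k₂ s₂ ≡ just i →
     (k₁ ≡ k₂) × (s₁ ≡ s₂))
  × (∀ i → i ≢ fromℕ (len π) → ∃[ k ] ∃[ side ] premiseAt π k side ≡ just i)

Axiom : ∀ {n} → CNF n → Clause n → Set
Axiom F D = Any (λ C → C ≈C D) F

xorSum : ∀ {m} → (Fin m → Bool) → Bool
xorSum {zero}  f = false
xorSum {suc m} f = f zero xor xorSum (λ j → f (suc j))

occurs : ∀ {n} → Clause n → Fin n → Bool
occurs C v = C v true ∨ C v false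

-- y_{v,j} is the variable combine v j of Fin (n * m).
-- D belongs to the canonical CNF of C[x_v := y_{v,1} ⊕ ... ⊕ y_{v,m}]:
-- D is the clause falsified exactly by some assignment α to the variables
-- {y_{v,j} : x_v occurs in C} that falsifies the substituted constraint.
XORClause : ∀ {n} (m : ℕ) → Clause n → Clause (n * m) → Set
XORClause {n} m C D =
  Σ (Fin n → Fin m → Bool) λ α →
    (∀ v b → C v b ≡ true → xorSum (α v) ≡ not b)
    × (∀ v j b → D (combine v j) b ≡ (occurs C v ∧ does (b B.≟ not (α v j))))

XORAxiom : ∀ {n} (m : ℕ) → CNF n → Clause (n * m) → Set
XORAxiom m F D = Any (λ C → XORClause m C D) F

-- Walk down the tree-like refutation of XOR_m(F) from its empty clause, keeping an assignment γ
-- to the variables y_{u,j} that falsifies the current clause C; the parities of its blocks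
-- y_{u,1} ⊕ ⋯ ⊕ y_{u,m} form an assignment a to the variables x_u.  At a resolution on y_{p,q}
-- the walk enters the premise falsified by γ, unless some other bit y_{p,j} is missing from C as
-- well.  Then the parity of block p is still free: the walk queries x_p, enters the smaller
-- premise once for each value of a p, and resolves the two clauses it gets back on x_p.  Every
-- query at least halves the size of the subtree still to be explored, so the extracted
-- refutation of F has depth at most log₂ s.  A clause extracted at C is falsified by a and
-- mentions x_u only if at least m − 1 bits of block u occur in C, whence (m − 1)·width ≤ w.

module Submission where

open import Defs
open import Data.Bool using (Bool; true; false; not; _∧_; _∨_; _xor_)
import Data.Bool as Bool
open import Data.Bool.Properties using (xor-assoc; xor-same; xor-identityʳ)
open import Data.Bool.Properties using (not-involutive; not-¬; ¬-not; ∨-zeroʳ)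
open import Data.Empty using (⊥; ⊥-elim)
open import Data.Fin using (Fin; zero; suc; toℕ; fromℕ; fromℕ<; combine; _↑ˡ_; _↑ʳ_)
import Data.Fin as Fin
open import Data.Fin.Properties using (toℕ<n; toℕ-fromℕ<; toℕ-fromℕ; toℕ≤pred[n]; injective⇒≤; any?)
open import Data.Fin.Properties using (combine-injectiveˡ; combine-injectiveʳ; combine-remQuot)
import Data.Fin.Properties as Finₚ
open import Data.List using (List; []; _∷_; _++_; length; lookup)
open import Data.List.Membership.Propositional using (_∈_; find)
open import Data.List.Membership.Propositional.Properties using (∈-++⁻; ∈-lookup)
open import Data.List.Properties using (length-++)
open import Data.List.Relation.Unary.All as All using ([]; _∷_)
open import Data.List.Relation.Unary.Any as Any using (here; there)
open import Data.List.Relation.Unary.Unique.Propositional using (Unique; []; _∷_)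
import Data.List.Relation.Unary.Unique.Propositional.Properties as Unique
open import Data.Maybe using (just)
open import Data.Nat using (ℕ; zero; suc; _+_; _*_; _∸_; _^_; _⊔_; _≤_; _<_; _<?_; z≤n; s≤s; s≤s⁻¹)
open import Data.Nat.Induction using (<-wellFounded)
open import Data.Nat.Logarithm using (⌊log₂_⌋; ⌊log₂⌋-mono-≤; ⌊log₂[2^n]⌋≡n)
open import Data.Nat.Properties
open import Data.Product using (Σ; Σ-syntax; _×_; _,_; proj₁; proj₂; ∃-syntax)
open import Data.Sum using (_⊎_; inj₁; inj₂)
open import Data.Unit using (⊤; tt)
open import Data.Vec.Functional using (Vector; updateAt)
open import Data.Vec.Functional.Properties using (updateAt-updates; updateAt-minimal)
open import Function using (const; _∘_)
open import Induction.WellFounded using (Acc; acc)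
open import Relation.Binary.Construct.Closure.ReflexiveTransitive as Star using (Star; ε; _◅_; _◅◅_)
open import Relation.Binary.PropositionalEquality
open import Relation.Nullary using (¬_; ¬?; Dec; yes; no; does; _×-dec_)

-- Finite sums and parities

_[_]≔_ : ∀ {A : Set} {M} → Vector A M → Fin M → A → Vector A M
f [ i ]≔ x = updateAt f i (const x)

sumFin-mono : ∀ {M} {f g : Fin M → ℕ} → (∀ i → f i ≤ g i) → sumFin f ≤ sumFin g
sumFin-mono {zero}  f≤g = z≤n
sumFin-mono {suc M} f≤g = +-mono-≤ (f≤g zero) (sumFin-mono (f≤g ∘ suc))

sumFin-zero : ∀ {M} {f : Fin M → ℕ} → (∀ i → f i ≡ 0) → sumFin f ≡ 0
sumFin-zero {zero}  f≡0 = refl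
sumFin-zero {suc M} f≡0 = cong₂ _+_ (f≡0 zero) (sumFin-zero (f≡0 ∘ suc))

*-distribˡ-sumFin : ∀ {M} c (f : Fin M → ℕ) → c * sumFin f ≡ sumFin (λ i → c * f i)
*-distribˡ-sumFin {zero}  c f = *-zeroʳ c
*-distribˡ-sumFin {suc M} c f =
  trans (*-distribˡ-+ c (f zero) _) (cong (c * f zero +_) (*-distribˡ-sumFin c (f ∘ suc)))

sumFin-++ : ∀ a b (f : Fin (a + b) → ℕ) →
            sumFin f ≡ sumFin (λ i → f (i ↑ˡ b)) + sumFin (λ i → f (a ↑ʳ i))
sumFin-++ zero    b f = refl
sumFin-++ (suc a) b f =
  trans (cong (f zero +_) (sumFin-++ a b (f ∘ suc))) (sym (+-assoc (f zero) _ _))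

sumFin-combine : ∀ n m (f : Fin (n * m) → ℕ) →
                 sumFin f ≡ sumFin {n} (λ u → sumFin {m} (λ j → f (combine u j)))
sumFin-combine zero    m f = refl
sumFin-combine (suc n) m f =
  trans (sumFin-++ m (n * m) f)
        (cong (sumFin (λ j → f (j ↑ˡ n * m)) +_) (sumFin-combine n m (λ z → f (m ↑ʳ z))))

count-all : ∀ {M} {f : Fin M → ℕ} → (∀ i → 1 ≤ f i) → M ≤ sumFin f
count-all {zero}  1≤f = z≤n
count-all {suc M} 1≤f = +-mono-≤ (1≤f zero) (count-all (1≤f ∘ suc))

count-except : ∀ {M} {f : Fin M → ℕ} q → (∀ i → i ≢ q → 1 ≤ f i) → M ∸ 1 ≤ sumFin f
count-except {suc M} zero    1≤f = ≤-trans (count-all (λ i → 1≤f (suc i) (λ ()))) (m≤n+m _ _)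
count-except {suc M} (suc q) 1≤f =
  ≤-trans (m≤n+m∸n M 1)
          (+-mono-≤ (1≤f zero (λ ()))
                    (count-except q (λ i i≢q → 1≤f (suc i) (i≢q ∘ Finₚ.suc-injective))))

xorSum-cong : ∀ {M} {f g : Fin M → Bool} → (∀ i → f i ≡ g i) → xorSum f ≡ xorSum g
xorSum-cong {zero}  f≗g = refl
xorSum-cong {suc M} f≗g = cong₂ _xor_ (f≗g zero) (xorSum-cong (f≗g ∘ suc))

xorSum-solve : ∀ {M} (f : Fin M → Bool) q c → ∃[ x ] xorSum (f [ q ]≔ x) ≡ c
xorSum-solve f zero c = c xor X , (begin
    (c xor X) xor X ≡⟨ xor-assoc c X X ⟩
    c xor (X xor X) ≡⟨ cong (c xor_) (xor-same X) ⟩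
    c xor false     ≡⟨ xor-identityʳ c ⟩
    c               ∎)
  where open ≡-Reasoning
        X : Bool
        X = xorSum (f ∘ suc)
xorSum-solve f (suc q) c with xorSum-solve (f ∘ suc) q (f zero xor c)
... | x , eq = x , (begin
    f zero xor xorSum ((f ∘ suc) [ q ]≔ x) ≡⟨ cong (f zero xor_) eq ⟩
    f zero xor (f zero xor c)             ≡⟨ xor-assoc (f zero) (f zero) c ⟨
    (f zero xor f zero) xor c             ≡⟨ cong (_xor c) (xor-same (f zero)) ⟩
    c                                     ∎)
  where open ≡-Reasoning

b2n-mono : ∀ {x y} → (x ≡ true → y ≡ true) → b2n x ≤ b2n y
b2n-mono {false} _   = z≤n
b2n-mono {true}  x⇒y rewrite x⇒y refl = ≤-refl

b2n-∨ : ∀ x y → b2n (x ∨ y) ≤ b2n x + b2n y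
b2n-∨ true  _ = s≤s z≤n
b2n-∨ false _ = ≤-refl

2^⊔-≤ : ∀ {d e s} → 2 ^ d ≤ s → 2 ^ e ≤ s → 2 ^ (d ⊔ e) ≤ s
2^⊔-≤ {d} {e} {s} 2^d≤s 2^e≤s with ⊔-sel d e
... | inj₁ d⊔e≡d = subst (λ x → 2 ^ x ≤ s) (sym d⊔e≡d) 2^d≤s
... | inj₂ d⊔e≡e = subst (λ x → 2 ^ x ≤ s) (sym d⊔e≡e) 2^e≤s

2*-≤ : ∀ {a b} → a ≤ b → 2 * a ≤ suc (a + b)
2*-≤ {a} a≤b = m≤n⇒m≤1+n (+-monoʳ-≤ a (≤-trans (≤-reflexive (+-identityʳ a)) a≤b))

log₂-lower : ∀ {d s} → 2 ^ d ≤ s → d ≤ ⌊log₂ s ⌋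
log₂-lower {d} 2^d≤s = subst (_≤ _) (⌊log₂[2^n]⌋≡n d) (⌊log₂⌋-mono-≤ 2^d≤s)

-- Clauses and assignments

module _ {N : ℕ} where

  Falsifies : (Fin N → Bool) → Clause N → Set
  Falsifies γ C = ∀ z b → C z b ≡ true → γ z ≡ not b

  _⊆_except_ : Clause N → Clause N → Fin N × Bool → Set
  K ⊆ C except (y , b) = ∀ z c → K z c ≡ true → C z c ≡ true ⊎ (z ≡ y × c ≡ b)

  literal? : (u v : Fin N) (c d : Bool) → Dec (u ≡ v × c ≡ d)
  literal? u v c d = (u Fin.≟ v) ×-dec (c Bool.≟ d)

  resolvent : Fin N → Clause N → Clause N → Clause N
  resolvent v A B u c = (A u c ∧ not (does (literal? u v c true)))
                      ∨ (B u c ∧ not (does (literal? u v c false)))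

  occurs-intro : ∀ (C : Clause N) {z} b → C z b ≡ true → occurs C z ≡ true
  occurs-intro C {z} true  Czb = cong (_∨ C z false) Czb
  occurs-intro C {z} false Czb with C z true
  ... | true  = refl
  ... | false = Czb

  occurs-elim : ∀ (C : Clause N) {z} → occurs C z ≡ true → ∃[ b ] C z b ≡ true
  occurs-elim C {z} occ with C z true in Czt
  ... | true  = true , Czt
  ... | false = false , occ

  occurs-⊆ : ∀ {K C y b z} → K ⊆ C except (y , b) → (z ≡ y → occurs C y ≡ true) →
             occurs K z ≡ true → occurs C z ≡ true
  occurs-⊆ {K} {C} K⊆ y∈C occ with occurs-elim K occ
  ... | c , Kzc with K⊆ _ c Kzc
  ...   | inj₁ Czc        = occurs-intro C c Czc
  ...   | inj₂ (refl , _) = y∈C refl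

  falsifies-agree : ∀ {γ γ′ C} → Falsifies γ C → (∀ z → occurs C z ≡ true → γ′ z ≡ γ z) →
                    Falsifies γ′ C
  falsifies-agree {C = C} fγ agree z b Czb = trans (agree z (occurs-intro C b Czb)) (fγ z b Czb)

  falsifies-premise : ∀ {γ K C y b} → K ⊆ C except (y , b) → Falsifies γ C → γ y ≡ not b →
                      Falsifies γ K
  falsifies-premise K⊆ fγ γy z c Kzc with K⊆ z c Kzc
  ... | inj₁ Czc           = fγ z c Czc
  ... | inj₂ (refl , refl) = γy

  resolvent-⊇ˡ : ∀ {v A B C} → IsResolvent v A B C → A ⊆ C except (v , true)
  resolvent-⊇ˡ {v} r u c Auc with literal? u v c true in lit?
  ... | yes lit = inj₂ lit
  ... | no ¬lit = inj₁ (trans (r u c) (survives _ Auc (cong does lit?)))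
    where survives : ∀ {a x} y → a ≡ true → x ≡ false → (a ∧ not x) ∨ y ≡ true
          survives _ refl refl = refl

  resolvent-⊇ʳ : ∀ {v A B C} → IsResolvent v A B C → B ⊆ C except (v , false)
  resolvent-⊇ʳ {v} r u c Buc with literal? u v c false in lit?
  ... | yes lit = inj₂ lit
  ... | no ¬lit = inj₁ (trans (r u c) (survives _ Buc (cong does lit?)))
    where survives : ∀ {b y} x → b ≡ true → y ≡ false → x ∨ (b ∧ not y) ≡ true
          survives x refl refl = ∨-zeroʳ x

  resolvent-cases : ∀ {v A B u c} → resolvent v A B u c ≡ true →
                    (A u c ≡ true × ¬ (u ≡ v × c ≡ true)) ⊎ (B u c ≡ true × ¬ (u ≡ v × c ≡ false))
  resolvent-cases {v} {A} {B} {u} {c} = split (A u c) (B u c) (literal? u v c true) (literal? u v c false)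
    where
    split : ∀ {P Q : Set} a b (p? : Dec P) (q? : Dec Q) →
            (a ∧ not (does p?)) ∨ (b ∧ not (does q?)) ≡ true → (a ≡ true × ¬ P) ⊎ (b ≡ true × ¬ Q)
    split true  _     (no ¬p) _       _  = inj₁ (refl , ¬p)
    split true  true  (yes _) (no ¬q) _  = inj₂ (refl , ¬q)
    split false true  _       (no ¬q) _  = inj₂ (refl , ¬q)
    split true  true  (yes _) (yes _) ()
    split true  false (yes _) _       ()
    split false true  _       (yes _) ()
    split false false _       _       ()

  occurs-≢ : ∀ {C : Clause N} {z y} → occurs C z ≡ true → occurs C y ≡ false → z ≢ y
  occurs-≢ z∈C y∉C refl with () ← trans (sym y∉C) z∈C

  empty-falsified : ∀ {γ C} → IsEmpty C → Falsifies γ C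
  empty-falsified empty z b Czb with () ← trans (sym (empty z b)) Czb

  variable-≢-updated : ∀ {a p cv E u c} → Falsifies (a [ p ]≔ cv) E → E u c ≡ true →
                       ¬ (u ≡ p × c ≡ not cv) → u ≢ p
  variable-≢-updated {a} {p} {cv} {c = c} fE Epc ¬lit refl = ¬lit (refl , c≡¬cv)
    where
    c≡¬cv : c ≡ not cv
    c≡¬cv = trans (sym (not-involutive c))
                  (cong not (trans (sym (fE p c Epc)) (updateAt-updates p a)))

-- Depth of a refutation

RespectsRank : ∀ {N S} {Ax : Clause N → Set} {cl : Fin S → Clause N} →
               (Fin S → ℕ) → (k : Fin S) → Step Ax cl k → Set
RespectsRank rank k (axiom _)             = ⊤
RespectsRank rank k (res i j _ _ _ _ _ _) = rank i < rank k × rank j < rank k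

module _ {N : ℕ} {Ax : Clause N → Set} (ρ : Refutation N Ax) (rank : Fin (size ρ) → ℕ)
         (respects : ∀ k → RespectsRank rank k (step ρ k)) where

  edge-rank-< : ∀ {i k} → Edge ρ i k → rank i < rank k
  edge-rank-< {k = k} (side , eq) with step ρ k | respects k
  edge-rank-< (true  , refl) | res _ _ _ _ _ _ _ _ | i< , _  = i<
  edge-rank-< (false , refl) | res _ _ _ _ _ _ _ _ | _ , j<  = j<

  path-rank : ∀ {a b ℓ} → Path ρ a b ℓ → rank a + ℓ ≤ rank b
  path-rank {a} here                  = ≤-reflexive (+-identityʳ (rank a))
  path-rank {a} (next {ℓ = ℓ} p e) =
    ≤-trans (≤-reflexive (+-suc (rank a) ℓ)) (≤-trans (s≤s (path-rank p)) (edge-rank-< e))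

  depth-≤-rank : ∀ {D} → (∀ k → rank k ≤ D) → DepthAtMost ρ D
  depth-≤-rank rank≤D a b ℓ p = ≤-trans (m≤n+m ℓ (rank a)) (≤-trans (path-rank p) (rank≤D b))

depthAtMost-mono : ∀ {N Ax} {ρ : Refutation N Ax} {d d′} → d ≤ d′ →
                   DepthAtMost ρ d → DepthAtMost ρ d′
depthAtMost-mono d≤d′ depth≤d a b ℓ path = ≤-trans (depth≤d a b ℓ path) d≤d′

-- Tree-like derivations and their flattening

data Derivation {N : ℕ} (Ax P : Clause N → Set) : Clause N → Set where
  axiom   : ∀ {C} → P C → Ax C → Derivation Ax P C
  resolve : ∀ {A B C} → P C → (v : Fin N) → A v true ≡ true → B v false ≡ true →
            IsResolvent v A B C → Derivation Ax P A → Derivation Ax P B → Derivation Ax P C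

module _ {N : ℕ} {Ax P : Clause N → Set} where

  lineCount : ∀ {C} → Derivation Ax P C → ℕ

  lastLine : ∀ {C} → Derivation Ax P C → ℕ
  lastLine (axiom _ _)               = 0
  lastLine (resolve _ _ _ _ _ TA TB) = lineCount TA + lineCount TB

  lineCount T = suc (lastLine T)

  depth : ∀ {C} → Derivation Ax P C → ℕ
  depth (axiom _ _)               = 0
  depth (resolve _ _ _ _ _ TA TB) = suc (depth TA ⊔ depth TB)

splice : ∀ {A : Set} → ℕ → (ℕ → A) → (ℕ → A) → ℕ → A
splice zero    f g k       = g k
splice (suc s) f g zero    = f zero
splice (suc s) f g (suc k) = splice s (f ∘ suc) g k

module _ {A : Set} where

  splice-< : ∀ {s k} (f g : ℕ → A) → k < s → splice s f g k ≡ f k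
  splice-< {suc s} {zero}  f g _         = refl
  splice-< {suc s} {suc k} f g (s≤s k<s) = splice-< (f ∘ suc) g k<s

  splice-+ : ∀ s k (f g : ℕ → A) → splice s f g (s + k) ≡ g k
  splice-+ zero    k f g = refl
  splice-+ (suc s) k f g = splice-+ s k (f ∘ suc) g

  splice-all : ∀ (Q : A → Set) {f g : ℕ → A} →
               (∀ k → Q (f k)) → (∀ k → Q (g k)) → ∀ s k → Q (splice s f g k)
  splice-all Q     Qf Qg zero    k       = Qg k
  splice-all Q     Qf Qg (suc s) zero    = Qf zero
  splice-all Q {f} Qf Qg (suc s) (suc k) = splice-all Q {f ∘ suc} (Qf ∘ suc) Qg s k

module _ {N : ℕ} where

  ResolutionOf : Clause N × ℕ → Clause N × ℕ → Clause N × ℕ → Set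
  ResolutionOf (A , a) (B , b) (C , c) =
    a < c × b < c × ∃[ v ] A v true ≡ true × B v false ≡ true × IsResolvent v A B C

  resolution-≡ : ∀ {L₁ L₂ L₃ M₁ M₂ M₃} → L₁ ≡ M₁ → L₂ ≡ M₂ → L₃ ≡ M₃ →
                 ResolutionOf L₁ L₂ L₃ → ResolutionOf M₁ M₂ M₃
  resolution-≡ refl refl refl r = r

module _ {N : ℕ} {Ax : Clause N → Set} where

  data Justified (σ : ℕ → Clause N × ℕ) (k : ℕ) : Set where
    by-axiom      : Ax (proj₁ (σ k)) → Justified σ k
    by-resolution : ∀ {i j} → i < k → j < k → ResolutionOf (σ i) (σ j) (σ k) → Justified σ k

  justified-shift : ∀ o {σ τ k} → (∀ i → i ≤ k → τ (o + i) ≡ σ i) →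
                    Justified σ k → Justified τ (o + k)
  justified-shift o τ≡σ (by-axiom ax) = by-axiom (subst (Ax ∘ proj₁) (sym (τ≡σ _ ≤-refl)) ax)
  justified-shift o τ≡σ (by-resolution i<k j<k r) =
    by-resolution (+-monoʳ-< o i<k) (+-monoʳ-< o j<k)
      (resolution-≡ (sym (τ≡σ _ (<⇒≤ i<k))) (sym (τ≡σ _ (<⇒≤ j<k))) (sym (τ≡σ _ ≤-refl)) r)

module _ {N : ℕ} {Ax P : Clause N → Set} where

  -- The lines of T in post-order, each paired with the depth of its subderivation: a rank that
  -- increases along every edge, hence bounds the length of every path.
  lines : ∀ {C} → Derivation Ax P C → ℕ → Clause N × ℕ
  lines {C} (axiom _ _)               _ = C , 0
  lines {C} T@(resolve _ _ _ _ _ TA TB) =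
    splice (lineCount TA) (lines TA) (splice (lineCount TB) (lines TB) (λ _ → C , depth T))

  lines-last : ∀ {C} (T : Derivation Ax P C) → lines T (lastLine T) ≡ (C , depth T)
  lines-last (axiom _ _)                        = refl
  lines-last {C} T@(resolve _ _ _ _ _ TA TB) = begin
    splice sA (lines TA) (splice sB (lines TB) root) (sA + sB) ≡⟨ splice-+ sA sB (lines TA) _ ⟩
    splice sB (lines TB) root sB                    ≡⟨ cong (splice sB (lines TB) root) (+-identityʳ sB) ⟨
    splice sB (lines TB) root (sB + 0)              ≡⟨ splice-+ sB 0 (lines TB) root ⟩
    (C , depth T)                                   ∎
    where open ≡-Reasoning
          sA sB : ℕ
          sA = lineCount TA
          sB = lineCount TB
          root : ℕ → Clause N × ℕ
          root _ = C , depth T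

  Admissible : ℕ → Clause N × ℕ → Set
  Admissible d (E , r) = P E × r ≤ d

  lines-sound : ∀ {C} (T : Derivation Ax P C) k → Admissible (depth T) (lines T k)
  lines-sound (axiom PC _)                   k = PC , z≤n
  lines-sound T@(resolve PC _ _ _ _ TA TB) =
    splice-all (Admissible (depth T)) {lines TA} (λ k → weaken _ (m≤m⊔n _ _) (lines-sound TA k))
      (splice-all (Admissible (depth T)) {lines TB} (λ k → weaken _ (m≤n⊔m _ _) (lines-sound TB k))
        (λ _ → PC , ≤-refl) (lineCount TB))
      (lineCount TA)
    where weaken : ∀ {d e} L → d ≤ e → Admissible d L → Admissible (suc e) L
          weaken _ d≤e (PE , r≤d) = PE , m≤n⇒m≤1+n (≤-trans r≤d d≤e)

  justified : ∀ {C} (T : Derivation Ax P C) k → k ≤ lastLine T → Justified {Ax = Ax} (lines T) k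
  justified (axiom _ ax) zero _ = by-axiom ax
  justified T@(resolve {A} {B} _ v hA hB r TA TB) k k≤last with k <? lineCount TA
  ... | yes k<sA =
    justified-shift 0 (λ i i≤k → splice-< (lines TA) _ (≤-<-trans i≤k k<sA))
      (justified TA k (s≤s⁻¹ k<sA))
  ... | no k≮sA with m≤n⇒∃[o]m+o≡n (≮⇒≥ k≮sA)
  ...   | k′ , refl with m≤n⇒m<n∨m≡n (+-cancelˡ-≤ (lineCount TA) _ _ k≤last)
  ...     | inj₁ k′<sB =
    justified-shift (lineCount TA)
      (λ i i≤k′ → trans (splice-+ (lineCount TA) i (lines TA) _)
                        (splice-< (lines TB) _ (≤-<-trans i≤k′ k′<sB)))
      (justified TB k′ (s≤s⁻¹ k′<sB))
  ...     | inj₂ refl =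
    by-resolution {i = lastLine TA} {j = lineCount TA + lastLine TB}
      (m≤m+n _ _) (+-monoʳ-< (lineCount TA) ≤-refl)
      (resolution-≡ (sym lineA) (sym lineB) (sym (lines-last T))
        (s≤s (m≤m⊔n (depth TA) (depth TB)) , s≤s (m≤n⊔m (depth TA) (depth TB)) , v , hA , hB , r))
    where
    lineA : lines T (lastLine TA) ≡ (A , depth TA)
    lineA = trans (splice-< (lines TA) _ ≤-refl) (lines-last TA)
    lineB : lines T (lineCount TA + lastLine TB) ≡ (B , depth TB)
    lineB = trans (splice-+ (lineCount TA) (lastLine TB) (lines TA) _)
                  (trans (splice-< (lines TB) _ ≤-refl) (lines-last TB))

  flatten : ∀ {C} (T : Derivation Ax P C) → IsEmpty C →
            Σ (Refutation N Ax) λ ρ → (∀ k → P (clause ρ k)) × DepthAtMost ρ (depth T)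
  flatten T empty =
    ρ , (λ k → proj₁ (lines-sound T (toℕ k))) ,
    depth-≤-rank ρ rankAt (λ k → proj₂ (stepAt k)) (λ k → proj₂ (lines-sound T (toℕ k)))
    where
    clauseAt : Fin (lineCount T) → Clause N
    clauseAt k = proj₁ (lines T (toℕ k))

    rankAt : Fin (lineCount T) → ℕ
    rankAt k = proj₂ (lines T (toℕ k))

    index : ∀ {i} (k : Fin (lineCount T)) → i < toℕ k → Fin (lineCount T)
    index k i<k = fromℕ< (<-trans i<k (toℕ<n k))

    lines-index : ∀ {i} k (i<k : i < toℕ k) → lines T i ≡ lines T (toℕ (index k i<k))
    lines-index k i<k = cong (lines T) (sym (toℕ-fromℕ< _))

    index-< : ∀ {i} k (i<k : i < toℕ k) → toℕ (index k i<k) < toℕ k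
    index-< k i<k = subst (_< toℕ k) (sym (toℕ-fromℕ< _)) i<k

    toStep : (k : Fin (lineCount T)) → Justified (lines T) (toℕ k) →
             Σ (Step Ax clauseAt k) (RespectsRank rankAt k)
    toStep k (by-axiom ax)             = axiom ax , tt
    toStep k (by-resolution i<k j<k r) =
      let ri , rj , v , hA , hB , isRes = resolution-≡ (lines-index k i<k) (lines-index k j<k) refl r
      in res (index k i<k) (index k j<k) (index-< k i<k) (index-< k j<k) v hA hB isRes , ri , rj

    stepAt : (k : Fin (lineCount T)) → Σ (Step Ax clauseAt k) (RespectsRank rankAt k)
    stepAt k = toStep k (justified T (toℕ k) (toℕ≤pred[n] k))

    last-empty : IsEmpty (clauseAt (fromℕ (lastLine T)))
    last-empty v b = trans (cong (λ L → proj₁ L v b) (trans (cong (lines T) (toℕ-fromℕ _)) (lines-last T)))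
                     (empty v b)

    ρ : Refutation N Ax
    ρ = record { len = lastLine T ; clause = clauseAt ; step = proj₁ ∘ stepAt ; ends = last-empty }

-- Unfolding a tree-like refutation

lookup-injective : ∀ {A : Set} {xs : List A} → Unique xs → ∀ {a b} → lookup xs a ≡ lookup xs b → a ≡ b
lookup-injective (_ ∷ _)      {zero}  {zero}  _  = refl
lookup-injective (x∉xs ∷ _)   {zero}  {suc b} eq = ⊥-elim (All.lookup x∉xs (∈-lookup b) eq)
lookup-injective (x∉xs ∷ _)   {suc a} {zero}  eq = ⊥-elim (All.lookup x∉xs (∈-lookup a) (sym eq))
lookup-injective (_ ∷ unique) {suc a} {suc b} eq = cong suc (lookup-injective unique eq)

unique-length≤ : ∀ {n} {xs : List (Fin n)} → Unique xs → length xs ≤ n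
unique-length≤ unique = injective⇒≤ (lookup-injective unique)

star-comparable : ∀ {A : Set} {R : A → A → Set} → (∀ {x y z} → R x y → R x z → y ≡ z) →
                  ∀ {x y z} → Star R x y → Star R x z → Star R y z ⊎ Star R z y
star-comparable det ε        xz        = inj₁ xz
star-comparable det (r ◅ xy) ε         = inj₂ (r ◅ xy)
star-comparable det (r ◅ xy) (r′ ◅ xz) with det r r′
... | refl = star-comparable det xy xz

module _ {N : ℕ} {Ax P : Clause N → Set} (π : Refutation N Ax) (Pπ : ∀ k → P (clause π k)) where

  unfold : (k : Fin (size π)) → Acc _<_ (toℕ k) → Derivation Ax P (clause π k)
  unfold k (acc rs) with step π k
  ... | axiom ax                  = axiom (Pπ k) ax
  ... | res i j i<k j<k v hi hj r = resolve (Pπ k) v hi hj r (unfold i (rs i<k)) (unfold j (rs j<k))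

  subproof : (k : Fin (size π)) → Acc _<_ (toℕ k) → List (Fin (size π))
  subproof k (acc rs) with step π k
  ... | axiom _                   = k ∷ []
  ... | res i j i<k j<k _ _ _ _   = k ∷ subproof i (rs i<k) ++ subproof j (rs j<k)

  lineCount-unfold : ∀ k a → lineCount (unfold k a) ≡ length (subproof k a)
  lineCount-unfold k (acc rs) with step π k
  ... | axiom _                   = refl
  ... | res i j i<k j<k _ _ _ _   =
    cong suc (trans (cong₂ _+_ (lineCount-unfold i (rs i<k)) (lineCount-unfold j (rs j<k)))
                    (sym (length-++ (subproof i (rs i<k)))))

  edge-< : ∀ {i k} → Edge π i k → toℕ i < toℕ k
  edge-< = edge-rank-< π toℕ respects
    where respects : ∀ k → RespectsRank toℕ k (step π k)
          respects k with step π k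
          ... | axiom _                 = tt
          ... | res _ _ i<k j<k _ _ _ _ = i<k , j<k

  reaches-≤ : ∀ {i k} → Star (Edge π) i k → toℕ i ≤ toℕ k
  reaches-≤ = Star.fold (λ i k → toℕ i ≤ toℕ k) (λ e i≤k → ≤-trans (<⇒≤ (edge-< e)) i≤k) ≤-refl

  premise-edges : ∀ {k i j i<k j<k v hi hj r} → step π k ≡ res i j i<k j<k v hi hj r →
                  premiseAt π k true ≡ just i × premiseAt π k false ≡ just j
  premise-edges eq rewrite eq = refl , refl

  subproof-reaches : ∀ k a {x} → x ∈ subproof k a → Star (Edge π) x k
  subproof-reaches k (acc rs) x∈ with step π k in eq | x∈
  ... | axiom _                 | here refl = ε
  ... | res i j i<k j<k _ _ _ _ | here refl = ε
  ... | res i j i<k j<k _ _ _ _ | there x∈′ with ∈-++⁻ (subproof i (rs i<k)) x∈′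
  ...   | inj₁ x∈i = subproof-reaches i (rs i<k) x∈i ◅◅ ((true , proj₁ (premise-edges eq)) ◅ ε)
  ...   | inj₂ x∈j = subproof-reaches j (rs j<k) x∈j ◅◅ ((false , proj₂ (premise-edges eq)) ◅ ε)

  module _ (treelike : Treelike π) where

    parent-unique : ∀ {x k k′} → Edge π x k → Edge π x k′ → k ≡ k′
    parent-unique (s , e) (s′ , e′) = proj₁ (proj₁ treelike _ s _ s′ _ e e′)

    premises-distinct : ∀ {k i} → premiseAt π k true ≡ just i → premiseAt π k false ≡ just i → ⊥
    premises-distinct pᵢ pⱼ with proj₂ (proj₁ treelike _ true _ false _ pᵢ pⱼ)
    ... | ()

    ancestor-of-premise : ∀ {i j k} → Edge π i k → Star (Edge π) i j → toℕ j < toℕ k → i ≡ j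
    ancestor-of-premise e ε          _   = refl
    ancestor-of-premise e (e′ ◅ k↝j) j<k with parent-unique e e′
    ... | refl = ⊥-elim (<⇒≱ j<k (reaches-≤ k↝j))

    premises-disjoint : ∀ {k i j} → premiseAt π k true ≡ just i → premiseAt π k false ≡ just j →
                        ∀ {x} → Star (Edge π) x i → Star (Edge π) x j → ⊥
    premises-disjoint pᵢ pⱼ x↝i x↝j with star-comparable parent-unique x↝i x↝j
    ... | inj₁ i↝j with refl ← ancestor-of-premise (true , pᵢ) i↝j (edge-< (false , pⱼ)) =
      premises-distinct pᵢ pⱼ
    ... | inj₂ j↝i with refl ← ancestor-of-premise (false , pⱼ) j↝i (edge-< (true , pᵢ)) =
      premises-distinct pᵢ pⱼ

    subproof-unique : ∀ k a → Unique (subproof k a)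
    subproof-unique k (acc rs) with step π k in eq
    ... | axiom _                 = [] ∷ []
    ... | res i j i<k j<k _ _ _ _ =
      All.tabulate k∉ ∷
      Unique.++⁺ (subproof-unique i (rs i<k)) (subproof-unique j (rs j<k))
        (λ (x∈i , x∈j) → premises-disjoint pᵢ pⱼ (subproof-reaches i (rs i<k) x∈i)
                                                  (subproof-reaches j (rs j<k) x∈j))
      where
      pᵢ : premiseAt π k true ≡ just i
      pᵢ = proj₁ (premise-edges eq)
      pⱼ : premiseAt π k false ≡ just j
      pⱼ = proj₂ (premise-edges eq)
      k∉ : ∀ {x} → x ∈ subproof i (rs i<k) ++ subproof j (rs j<k) → k ≢ x
      k∉ x∈ refl with ∈-++⁻ (subproof i (rs i<k)) x∈
      ... | inj₁ k∈i = <⇒≱ i<k (reaches-≤ (subproof-reaches i (rs i<k) k∈i))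
      ... | inj₂ k∈j = <⇒≱ j<k (reaches-≤ (subproof-reaches j (rs j<k) k∈j))

    lineCount-unfold-≤ : ∀ k a → lineCount (unfold k a) ≤ size π
    lineCount-unfold-≤ k a =
      ≤-trans (≤-reflexive (lineCount-unfold k a)) (unique-length≤ (subproof-unique k a))

-- The lifting argument

module Lifting {n : ℕ} (F : CNF n) (m w : ℕ) where

  block : ∀ {A : Set} → (Fin (n * m) → A) → Fin n → Fin m → A
  block γ u j = γ (combine u j)

  XorConsistent : (Fin (n * m) → Bool) → (Fin n → Bool) → Set
  XorConsistent γ a = ∀ u → xorSum (block γ u) ≡ a u

  blockCount : Clause (n * m) → Fin n → ℕ
  blockCount C u = sumFin (λ j → b2n (occurs C (combine u j)))

  Supported : Clause (n * m) → Clause n → Set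
  Supported C E = ∀ u b → E u b ≡ true → m ∸ 1 ≤ blockCount C u

  WidthOK : Clause n → Set
  WidthOK E = (m ∸ 1) * clauseWidth E ≤ w

  supported-width : ∀ {a C E} → Falsifies a E → Supported C E →
                    (m ∸ 1) * clauseWidth E ≤ clauseWidth C
  supported-width {a} {C} {E} fE sE = begin
    (m ∸ 1) * clauseWidth E                        ≡⟨ *-distribˡ-sumFin (m ∸ 1) literals ⟩
    sumFin (λ u → (m ∸ 1) * literals u)            ≤⟨ sumFin-mono per-variable ⟩
    sumFin (blockCount C)                          ≡⟨ sumFin-combine n m (λ z → b2n (occurs C z)) ⟨
    sumFin (λ z → b2n (occurs C z))                ≤⟨ sumFin-mono (λ z → b2n-∨ (C z true) (C z false)) ⟩
    clauseWidth C                                  ∎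
    where
    open ≤-Reasoning
    literals : Fin n → ℕ
    literals u = b2n (E u true) + b2n (E u false)

    per-variable : ∀ u → (m ∸ 1) * literals u ≤ blockCount C u
    per-variable u with E u true in Eut | E u false in Euf
    ... | true  | true  with () ← trans (sym (fE u true Eut)) (fE u false Euf)
    ... | true  | false = subst (_≤ blockCount C u) (sym (*-identityʳ (m ∸ 1))) (sE u true Eut)
    ... | false | true  = subst (_≤ blockCount C u) (sym (*-identityʳ (m ∸ 1))) (sE u false Euf)
    ... | false | false = subst (_≤ blockCount C u) (sym (*-zeroʳ (m ∸ 1))) z≤n

  widthOK : ∀ {a C E} → clauseWidth C ≤ w → Falsifies a E → Supported C E → WidthOK E
  widthOK {C = C} wC fE sE = ≤-trans (supported-width {C = C} fE sE) wC

  record Extraction (C : Clause (n * m)) (a : Fin n → Bool) (bound : ℕ) : Set where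
    constructor extracted
    field
      {conclusion} : Clause n
      derivation   : Derivation (Axiom F) WidthOK conclusion
      shallow      : 2 ^ depth derivation ≤ bound
      falsified    : Falsifies a conclusion
      supported    : Supported C conclusion

  Extracts : Clause (n * m) → ℕ → Set
  Extracts C s = ∀ γ a → Falsifies γ C → XorConsistent γ a → Extraction C a s

  extracts-weaken : ∀ {C s s′} → s ≤ s′ → Extracts C s → Extracts C s′
  extracts-weaken s≤s′ exC γ a fγ cγ with exC γ a fγ cγ
  ... | extracted T shallow fE sE = extracted T (≤-trans shallow s≤s′) fE sE

  blockCount-mono : ∀ {K C u} →
                    (∀ j → occurs K (combine u j) ≡ true → occurs C (combine u j) ≡ true) →
                    blockCount K u ≤ blockCount C u
  blockCount-mono K⇒C = sumFin-mono (λ j → b2n-mono (K⇒C j))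

  full-block : ∀ {C u} → (∀ j → occurs C (combine u j) ≡ true) → m ∸ 1 ≤ blockCount C u
  full-block full = ≤-trans (m∸n≤m m 1) (count-all (λ j → ≤-reflexive (cong b2n (sym (full j)))))

  extract-axiom : ∀ {C} → clauseWidth C ≤ w → XORAxiom m F C → Extracts C 1
  extract-axiom {C} wC ax γ a fγ cγ with find ax
  ... | K , K∈F , α , α-falsifies , C≡ =
    extracted (axiom (widthOK {C = C} wC fK sK) (Any.map (λ { refl _ _ → refl }) K∈F)) ≤-refl fK sK
    where
    block-literal : ∀ {v} → occurs K v ≡ true → ∀ j → C (combine v j) (not (α v j)) ≡ true
    block-literal {v} Kv j rewrite C≡ v j (not (α v j)) | Kv with α v j
    ... | true  = refl
    ... | false = refl

    γ≡α : ∀ {v} → occurs K v ≡ true → ∀ j → block γ v j ≡ α v j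
    γ≡α Kv j = trans (fγ _ _ (block-literal Kv j)) (not-involutive _)

    fK : Falsifies a K
    fK v b Kvb = trans (sym (cγ v))
                       (trans (xorSum-cong (γ≡α (occurs-intro K b Kvb))) (α-falsifies v b Kvb))

    sK : Supported C K
    sK v b Kvb = full-block {C} (λ j → occurs-intro C _ (block-literal (occurs-intro K b Kvb) j))

  block-update-same : ∀ {A : Set} (γ : Fin (n * m) → A) p j x j′ →
                      block (γ [ combine p j ]≔ x) p j′ ≡ (block γ p [ j ]≔ x) j′
  block-update-same γ p j x j′ with j′ Fin.≟ j
  ... | yes refl = trans (updateAt-updates (combine p j) γ) (sym (updateAt-updates j (block γ p)))
  ... | no j′≢j  = trans (updateAt-minimal _ _ γ (j′≢j ∘ combine-injectiveʳ p j′ p j))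
                         (sym (updateAt-minimal j′ j (block γ p) j′≢j))

  block-update-other : ∀ {A : Set} (γ : Fin (n * m) → A) {p u} j x → u ≢ p → ∀ j′ →
                       block (γ [ combine p j ]≔ x) u j′ ≡ block γ u j′
  block-update-other γ {p} {u} j x u≢p j′ = updateAt-minimal _ _ γ (u≢p ∘ combine-injectiveˡ u j′ p j)

  reassign : ∀ {p q j} → j ≢ q → ∀ γ x cv {a} → XorConsistent γ a →
             Σ[ γ′ ∈ (Fin (n * m) → Bool) ]
               γ′ (combine p q) ≡ x
             × (∀ z → z ≢ combine p q → z ≢ combine p j → γ′ z ≡ γ z)
             × XorConsistent γ′ (a [ p ]≔ cv)
  reassign {p} {q} {j} j≢q γ x cv {a} cγ = γ′ , γ′-at-q , γ′-elsewhere , consistent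
    where
    γ₁ : Fin (n * m) → Bool
    γ₁ = γ [ combine p q ]≔ x

    solved : ∃[ x′ ] xorSum (block γ₁ p [ j ]≔ x′) ≡ cv
    solved = xorSum-solve (block γ₁ p) j cv

    γ′ : Fin (n * m) → Bool
    γ′ = γ₁ [ combine p j ]≔ proj₁ solved

    γ′-at-q : γ′ (combine p q) ≡ x
    γ′-at-q = trans (updateAt-minimal _ _ γ₁ (j≢q ∘ sym ∘ combine-injectiveʳ p q p j))
                    (updateAt-updates (combine p q) γ)

    γ′-elsewhere : ∀ z → z ≢ combine p q → z ≢ combine p j → γ′ z ≡ γ z
    γ′-elsewhere z z≢q z≢j = trans (updateAt-minimal _ _ γ₁ z≢j) (updateAt-minimal _ _ γ z≢q)

    consistent : XorConsistent γ′ (a [ p ]≔ cv)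
    consistent u with u Fin.≟ p
    ... | yes refl = trans (xorSum-cong (block-update-same γ₁ p j _))
                           (trans (proj₂ solved) (sym (updateAt-updates p a)))
    ... | no u≢p   = trans (xorSum-cong (λ j′ → trans (block-update-other γ₁ j _ u≢p j′)
                                                      (block-update-other γ q x u≢p j′)))
                           (trans (cγ u) (sym (updateAt-minimal u p a u≢p)))

  blockCount-premise : ∀ {K C p q b u} → K ⊆ C except (combine p q , b) → u ≢ p →
                       blockCount K u ≤ blockCount C u
  blockCount-premise {K} {C} {p} {q} {u = u} K⊆ u≢p =
    blockCount-mono {K} {C} (λ j → occurs-⊆ K⊆ (⊥-elim ∘ u≢p ∘ combine-injectiveˡ u j p q))

  supported-premise : ∀ {K C p q b E} → K ⊆ C except (combine p q , b) → Supported K E →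
                      (∀ c → E p c ≡ true → m ∸ 1 ≤ blockCount C p) → Supported C E
  supported-premise {p = p} K⊆ sK at-p u c Euc with u Fin.≟ p
  ... | yes refl = at-p c Euc
  ... | no u≢p   = ≤-trans (sK u c Euc) (blockCount-premise K⊆ u≢p)

  -- The value of y_{p,q} is forced by C and the parity of block p unless y_{p,q} and some other
  -- bit y_{p,j} are both missing from C.
  Forced : Clause (n * m) → Fin n → Fin m → Set
  Forced C p q = occurs C (combine p q) ≡ true ⊎ (∀ j → j ≢ q → occurs C (combine p j) ≡ true)

  forced-supported : ∀ {K C p q b E} → Forced C p q → K ⊆ C except (combine p q , b) →
                     Supported K E → ∀ c → E p c ≡ true → m ∸ 1 ≤ blockCount C p
  forced-supported {K} {C} (inj₁ y∈C) K⊆ sE c Epc =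
    ≤-trans (sE _ c Epc) (blockCount-mono {K} {C} (λ j → occurs-⊆ K⊆ (λ _ → y∈C)))
  forced-supported {q = q} (inj₂ others) _ _ _ _ =
    count-except q (λ j j≢q → ≤-reflexive (cong b2n (sym (others j j≢q))))

  descend : ∀ {K C p q b s s′ γ a} → Forced C p q → K ⊆ C except (combine p q , b) →
            Extracts K s → s ≤ s′ → Falsifies γ C → XorConsistent γ a → γ (combine p q) ≡ not b →
            Extraction C a s′
  descend {γ = γ} {a} forced K⊆ exK s≤s′ fγ cγ γy with exK γ a (falsifies-premise K⊆ fγ γy) cγ
  ... | extracted T shallow fE sE =
    extracted T (≤-trans shallow s≤s′) fE (supported-premise K⊆ sE (forced-supported forced K⊆ sE))

  extract-follow : ∀ {A B C p q sA sB} → Forced C p q →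
                   A ⊆ C except (combine p q , true) → B ⊆ C except (combine p q , false) →
                   Extracts A sA → Extracts B sB → Extracts C (suc (sA + sB))
  extract-follow {p = p} {q} {sA} {sB} forced A⊆ B⊆ exA exB γ a fγ cγ with γ (combine p q) in γy
  ... | false = descend forced A⊆ exA (m≤n⇒m≤1+n (m≤m+n sA sB)) fγ cγ γy
  ... | true  = descend forced B⊆ exB (m≤n⇒m≤1+n (m≤n+m sB sA)) fγ cγ γy

  transfer-literal : ∀ {K C p q b a cv E u c} → K ⊆ C except (combine p q , b) →
                     Falsifies (a [ p ]≔ cv) E → Supported K E → E u c ≡ true → u ≢ p →
                     a u ≡ not c × m ∸ 1 ≤ blockCount C u
  transfer-literal {p = p} {a = a} K⊆ fE sE Euc u≢p =
    trans (sym (updateAt-minimal _ p a u≢p)) (fE _ _ Euc) ,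
    ≤-trans (sE _ _ Euc) (blockCount-premise K⊆ u≢p)

  answer-unused : ∀ {K C p q b a cv s s′} → K ⊆ C except (combine p q , b) →
                  (e : Extraction K (a [ p ]≔ cv) s) → Extraction.conclusion e p (not cv) ≡ false →
                  s ≤ s′ → Extraction C a s′
  answer-unused {C = C} {a = a} K⊆ (extracted {E} T shallow fE sE) no-literal s≤s′ =
    extracted T (≤-trans shallow s≤s′) (λ u c → proj₁ ∘ literal u c) (λ u c → proj₂ ∘ literal u c)
    where
    literal : ∀ u c → E u c ≡ true → a u ≡ not c × m ∸ 1 ≤ blockCount C u
    literal u c Euc = transfer-literal K⊆ fE sE Euc
                        (variable-≢-updated fE Euc (λ { (refl , refl) → not-¬ no-literal Euc }))

  resolve-answers : ∀ {K C p q b a s} → clauseWidth C ≤ w → K ⊆ C except (combine p q , b) →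
                    (e₀ : Extraction K (a [ p ]≔ false) s) (e₁ : Extraction K (a [ p ]≔ true) s) →
                    Extraction.conclusion e₀ p true ≡ true → Extraction.conclusion e₁ p false ≡ true →
                    Extraction C a (2 * s)
  resolve-answers {C = C} {p} {a = a} wC K⊆ (extracted {E₀} T₀ sh₀ f₀ s₀) (extracted {E₁} T₁ sh₁ f₁ s₁)
                  x∈E₀ x̄∈E₁ =
    extracted (resolve (widthOK {C = C} wC fR sR) p x∈E₀ x̄∈E₁ (λ _ _ → refl) T₀ T₁)
              (*-monoʳ-≤ 2 (2^⊔-≤ {depth T₀} {depth T₁} sh₀ sh₁)) fR sR
    where
    literal : ∀ u c → resolvent p E₀ E₁ u c ≡ true → a u ≡ not c × m ∸ 1 ≤ blockCount C u
    literal u c Ruc with resolvent-cases {v = p} {E₀} {E₁} Ruc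
    ... | inj₁ (E₀uc , ¬x) = transfer-literal K⊆ f₀ s₀ E₀uc (variable-≢-updated f₀ E₀uc ¬x)
    ... | inj₂ (E₁uc , ¬x̄) = transfer-literal K⊆ f₁ s₁ E₁uc (variable-≢-updated f₁ E₁uc ¬x̄)

    fR : Falsifies a (resolvent p E₀ E₁)
    fR u c = proj₁ ∘ literal u c

    sR : Supported C (resolvent p E₀ E₁)
    sR u c = proj₂ ∘ literal u c

  merge-answers : ∀ {K C p q b a s} → clauseWidth C ≤ w → K ⊆ C except (combine p q , b) →
          Extraction K (a [ p ]≔ false) s → Extraction K (a [ p ]≔ true) s → Extraction C a (2 * s)
  merge-answers {p = p} {s = s} wC K⊆ e₀ e₁
    with Extraction.conclusion e₀ p true in x∈E₀ | Extraction.conclusion e₁ p false in x̄∈E₁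
  ... | false | _     = answer-unused K⊆ e₀ x∈E₀ (m≤m+n s _)
  ... | true  | false = answer-unused K⊆ e₁ x̄∈E₁ (m≤m+n s _)
  ... | true  | true  = resolve-answers wC K⊆ e₀ e₁ x∈E₀ x̄∈E₁

  extract-query : ∀ {K C p q j b s} → clauseWidth C ≤ w → K ⊆ C except (combine p q , b) →
                  Extracts K s → occurs C (combine p q) ≡ false → j ≢ q → occurs C (combine p j) ≡ false →
                  Extracts C (2 * s)
  extract-query {K} {C} {p} {q} {j} {b} {s} wC K⊆ exK y∉C j≢q j∉C γ a fγ cγ =
    merge-answers wC K⊆ (run false) (run true)
    where
    run : ∀ cv → Extraction K (a [ p ]≔ cv) s
    run cv with reassign j≢q γ (not b) cv cγ
    ... | γ′ , γ′y , γ′-elsewhere , cγ′ =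
      exK γ′ (a [ p ]≔ cv) (falsifies-premise K⊆ (falsifies-agree fγ agree) γ′y) cγ′
      where
      agree : ∀ z → occurs C z ≡ true → γ′ z ≡ γ z
      agree z z∈C = γ′-elsewhere z (occurs-≢ {C = C} z∈C y∉C) (occurs-≢ {C = C} z∈C j∉C)

  data BlockBit : Fin (n * m) → Set where
    bit : (p : Fin n) (q : Fin m) → BlockBit (combine p q)

  blockBit : ∀ y → BlockBit y
  blockBit y = subst BlockBit (combine-remQuot {n} m y) (bit _ _)

  extract-resolve : ∀ {A B C y sA sB} → clauseWidth C ≤ w → IsResolvent y A B C →
                    Extracts A sA → Extracts B sB → Extracts C (suc (sA + sB))
  extract-resolve {C = C} {y} {sA} {sB} wC r exA exB with blockBit y
  ... | bit p q with occurs C (combine p q) in y∈C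
                   | any? (λ j → ¬? (j Fin.≟ q) ×-dec (occurs C (combine p j) Bool.≟ false))
  ...   | true  | _ = extract-follow (inj₁ y∈C) (resolvent-⊇ˡ r) (resolvent-⊇ʳ r) exA exB
  ...   | false | no none-free =
    extract-follow (inj₂ (λ j j≢q → ¬-not (λ j∉C → none-free (j , j≢q , j∉C))))
                   (resolvent-⊇ˡ r) (resolvent-⊇ʳ r) exA exB
  ...   | false | yes (j , j≢q , j∉C) with ≤-total sA sB
  ...     | inj₁ sA≤sB = extracts-weaken (2*-≤ sA≤sB)
                                         (extract-query wC (resolvent-⊇ˡ r) exA y∈C j≢q j∉C)
  ...     | inj₂ sB≤sA = extracts-weaken (subst (2 * sB ≤_) (cong suc (+-comm sB sA)) (2*-≤ sB≤sA))
                                         (extract-query wC (resolvent-⊇ʳ r) exB y∈C j≢q j∉C)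

  extract : ∀ {C} (T : Derivation (XORAxiom m F) (λ C → clauseWidth C ≤ w) C) →
            Extracts C (lineCount T)
  extract (axiom wC ax)              = extract-axiom wC ax
  extract (resolve wC _ _ _ r TA TB) = extract-resolve wC r (extract TA) (extract TB)

  blockCount-empty : ∀ {C u} → IsEmpty C → blockCount C u ≡ 0
  blockCount-empty {u = u} empty =
    sumFin-zero (λ j → cong b2n (cong₂ _∨_ (empty (combine u j) true) (empty (combine u j) false)))

  supported-by-empty : ∀ {C E} → 2 ≤ m → IsEmpty C → Supported C E → IsEmpty E
  supported-by-empty {C} {E} 2≤m empty sE u b with E u b in Eub
  ... | false = refl
  ... | true  with () ← ≤-trans (∸-monoˡ-≤ 1 2≤m)
                                (≤-trans (sE u b Eub) (≤-reflexive (blockCount-empty empty)))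

mainTheorem8 : ∀ {n} (F : CNF n) (m : ℕ) → 2 ≤ m → (w : ℕ)
    → (π : Refutation (n * m) (XORAxiom m F)) → Treelike π → WidthAtMost π w
    → Σ (Refutation n (Axiom F)) λ ρ →
        (∀ k → (m ∸ 1) * clauseWidth (clause ρ k) ≤ w)
        × DepthAtMost ρ ⌊log₂ size π ⌋
mainTheorem8 {n} F m 2≤m w π treelike narrow =
  let open Lifting F m w
      root : Fin (size π)
      root = fromℕ (len π)
      acc₀ : Acc _<_ (toℕ root)
      acc₀ = <-wellFounded (toℕ root)
      T : Derivation (XORAxiom m F) (λ C → clauseWidth C ≤ w) (clause π root)
      T = unfold π narrow root acc₀
      γ : Fin (n * m) → Bool
      γ _ = false
      extracted T′ shallow _ supported =
        extract T γ (λ u → xorSum (block γ u)) (empty-falsified (ends π)) (λ _ → refl)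
      ρ , narrowρ , depthρ = flatten T′ (supported-by-empty 2≤m (ends π) supported)
      small : 2 ^ depth T′ ≤ size π
      small = ≤-trans shallow (lineCount-unfold-≤ π narrow treelike root acc₀)
  in ρ , narrowρ , depthAtMost-mono (log₂-lower small) depthρ
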